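{- A unicyclic graph that has a vertex of degree at least four, or has a vertex of degree three not contained in its cycle, is not in $\mathcal{G}^{\rm SSP}$.
   Context: All graphs are finite, simple and undirected; a unicyclic graph is a connected graph containing exactly one cycle. For a graph $G$ on vertex set $\{1,\dots,n\}$, $\mathcal{S}(G)$ denotes the set of real symmetric $n\times n$ matrices $A=[a_{ij}]$ such that for $i\neq j$, $a_{ij}\neq 0$ if and only if $\{i,j\}\in E(G)$ (diagonal entries unrestricted). A real symmetric matrix $A$ has the strong spectral property (SSP) if the only real symmetric matrix $X$ satisfying $A\circ X=0$, $I\circ X=0$ and $AX-XA=0$ is $X=0$ (entrywise product $\circ$). $\mathcal{G}^{\rm SSP}$ denotes the set of all graphs $G$ such that every matrix in $\mathcal{S}(G)$ has the SSP. -}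

module Defs where

open import Level using (0ℓ)
open import Data.Nat using (ℕ; zero; suc; _≤_)
open import Data.Fin using (Fin)
import Data.Fin as Fin
open import Data.Sum using (_⊎_)
open import Data.Unit using (⊤)
open import Data.Empty using (⊥)
open import Data.Bool using (Bool; true; false; if_then_else_)
open import Data.Nat.ListAction using (sum)
open import Data.List using (List; []; _∷_; length; map; _++_; allFin)
open import Data.List.Relation.Unary.Unique.Propositional using (Unique)
open import Data.List.Membership.Propositional using (_∈_)
open import Data.Product using (Σ; ∃; _×_; _,_)
open import Relation.Nullary using (¬_)
open import Relation.Binary.PropositionalEquality using (_≡_; _≢_)
open import Function.Bundles using (_⇔_)
open import Algebra.Bundles using (CommutativeRing)

-- The real numbers, axiomatised as a Dedekind-complete ordered field
-- (unique up to isomorphism classically).  Statements quantify over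
-- an arbitrary model.

record RealField : Set₁ where
  field
    commRing : CommutativeRing 0ℓ 0ℓ
  open CommutativeRing commRing public
  field
    0≉1      : ¬ (0# ≈ 1#)
    inverse  : ∀ x → ¬ (x ≈ 0#) → ∃ λ y → (x * y) ≈ 1#
    _≤ᵣ_     : Carrier → Carrier → Set
    ≤-resp   : ∀ {x x' y y'} → x ≈ x' → y ≈ y' → x ≤ᵣ y → x' ≤ᵣ y'
    ≤-refl   : ∀ {x} → x ≤ᵣ x
    ≤-trans  : ∀ {x y z} → x ≤ᵣ y → y ≤ᵣ z → x ≤ᵣ z
    ≤-antisym : ∀ {x y} → x ≤ᵣ y → y ≤ᵣ x → x ≈ y
    ≤-total  : ∀ x y → (x ≤ᵣ y) ⊎ (y ≤ᵣ x)
    +-mono   : ∀ {x y} z → x ≤ᵣ y → (x + z) ≤ᵣ (y + z)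
    *-nonneg : ∀ {x y} → 0# ≤ᵣ x → 0# ≤ᵣ y → 0# ≤ᵣ (x * y)
    complete : (P : Carrier → Set) → ∃ P → (∃ λ b → ∀ x → P x → x ≤ᵣ b) →
               ∃ λ s → (∀ x → P x → x ≤ᵣ s) ×
                       (∀ b → (∀ x → P x → x ≤ᵣ b) → s ≤ᵣ b)

record Graph (n : ℕ) : Set where
  field
    adj     : Fin n → Fin n → Bool
    sym     : ∀ i j → adj i j ≡ adj j i
    irrefl  : ∀ i → adj i i ≡ false
open Graph public

Adj : ∀ {n} → Graph n → Fin n → Fin n → Set
Adj G i j = adj G i j ≡ true

degree : ∀ {n} → Graph n → Fin n → ℕ
degree {n} G v = sum (map (λ u → if adj G v u then 1 else 0) (allFin n))

data Walk {n} (G : Graph n) : Fin n → Fin n → Set where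
  here : ∀ {v} → Walk G v v
  step : ∀ {u v w} → Adj G u v → Walk G v w → Walk G u w

Connected : ∀ {n} → Graph n → Set
Connected {n} G = ∀ (u v : Fin n) → Walk G u v

Path : ∀ {n} → Graph n → List (Fin n) → Set
Path G []           = ⊤
Path G (x ∷ [])     = ⊤
Path G (x ∷ y ∷ xs) = Adj G x y × Path G (y ∷ xs)

last : ∀ {n} → Fin n → List (Fin n) → Fin n
last x []       = x
last x (y ∷ ys) = last y ys

record Cycle {n} (G : Graph n) : Set where
  constructor cyc
  field
    v₀     : Fin n
    rest   : List (Fin n)
    len≥3  : 3 ≤ length (v₀ ∷ rest)
    distinct : Unique (v₀ ∷ rest)
    path   : Path G (v₀ ∷ rest)
    closes : Adj G (last v₀ rest) v₀
open Cycle public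

ConsecIn : ∀ {n} → List (Fin n) → Fin n → Fin n → Set
ConsecIn []           a b = ⊥
ConsecIn (x ∷ [])     a b = ⊥
ConsecIn (x ∷ y ∷ xs) a b =
  ((a ≡ x × b ≡ y) ⊎ (a ≡ y × b ≡ x)) ⊎ ConsecIn (y ∷ xs) a b

CycleEdge : ∀ {n} {G : Graph n} → Cycle G → Fin n → Fin n → Set
CycleEdge C a b = ConsecIn (v₀ C ∷ rest C ++ (v₀ C ∷ [])) a b

OnCycle : ∀ {n} {G : Graph n} → Fin n → Cycle G → Set
OnCycle v C = v ∈ (v₀ C ∷ rest C)

-- two cycles are the same subgraph iff they have the same edge set
SameCycle : ∀ {n} {G : Graph n} → Cycle G → Cycle G → Set
SameCycle C D = ∀ a b → CycleEdge C a b ⇔ CycleEdge D a b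

Unicyclic : ∀ {n} → Graph n → Set
Unicyclic G = Connected G × (Σ (Cycle G) λ C → ∀ (D : Cycle G) → SameCycle C D)

module _ (ℝ : RealField) where
  open RealField ℝ

  Matrix : ℕ → Set
  Matrix n = Fin n → Fin n → Carrier

  Σᶠ : ∀ {n} → (Fin n → Carrier) → Carrier
  Σᶠ {zero}  f = 0#
  Σᶠ {suc n} f = f Fin.zero + Σᶠ (λ i → f (Fin.suc i))

  _⊗_ : ∀ {n} → Matrix n → Matrix n → Matrix n
  (A ⊗ B) i j = Σᶠ (λ k → A i k * B k j)

  Symmetric : ∀ {n} → Matrix n → Set
  Symmetric A = ∀ i j → A i j ≈ A j i

  InS : ∀ {n} → Graph n → Matrix n → Set
  InS G A = Symmetric A ×
            (∀ i j → i ≢ j → (¬ (A i j ≈ 0#)) ⇔ Adj G i j)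

  SSP : ∀ {n} → Matrix n → Set
  SSP A = ∀ X → Symmetric X →
          (∀ i j → (A i j * X i j) ≈ 0#) →
          (∀ i → X i i ≈ 0#) →
          (∀ i j → (A ⊗ X) i j ≈ (X ⊗ A) i j) →
          ∀ i j → X i j ≈ 0#

  InGSSP : ∀ {n} → Graph n → Set
  InGSSP G = ∀ A → InS G A → SSP A

module Submission where

-- Obstruction (LinearAlgebra.NullPair): if A x = A y = 0, x, y ≠ 0 and x i y j = 0 whenever
-- i = j or i ~ j, then X = x yᵀ + y xᵀ ≠ 0 is symmetric with A ∘ X = I ∘ X = 0, AX = 0 = XA.
-- Construction (LinearAlgebra.Construction): with special vertices v, w, edge weights 1
-- except −1 on one edge w–q, and minus the inner degree on the inner diagonal, indicators of
-- components of G − {v, w} are null on inner rows.  Hence z_a − z_b is null for two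
-- "pendant" components hanging off one special vertex by single edges, and z_p is null for
-- a "balanced" component attached only to w, by edges w–p, w–q of weights 1 and −1.
-- Graph part (Walks, Cycles, Neighbourhoods): a walk between two neighbours of s avoiding s
-- closes a cycle, necessarily the unique one.  This locates such components around a vertex
-- of degree ≥ 4, resp. around a degree-3 vertex v off the cycle and the cycle vertex w first
-- reached from v (Cases).  Reachability is decided under double negation, which suffices
-- as the theorem is a negation.

open import Defs
open import Data.Nat using (ℕ; zero; suc; _≤_; z≤n; s≤s)
open import Data.Nat.Properties using (≤-trans; ≤-refl)
open import Data.Fin using (Fin)
import Data.Fin as Fin
open import Data.Fin.Properties using (_≟_; suc-injective)
open import Data.Bool using (Bool; true; false; if_then_else_; _∧_; _∨_)
import Data.Bool as Bool
open import Data.List using (List; []; _∷_; length; _++_; map; allFin; filter)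
open import Data.List.Properties using (filter-all)
open import Data.Nat.ListAction using () renaming (sum to sumℕ)
open import Data.List.Membership.Propositional using (_∈_)
open import Data.List.Membership.Propositional.Properties using (∈-∃++; ∈-++⁻)
open import Data.List.Relation.Unary.All as All using (All; []; _∷_)
open import Data.List.Relation.Unary.All.Properties
  using (¬Any⇒All¬; all-filter) renaming (filter⁺ to all-filter⁺)
open import Data.List.Relation.Unary.Any using (here; there)
open import Data.List.Relation.Unary.AllPairs using ([]; _∷_)
open import Data.List.Relation.Unary.Unique.Propositional using (Unique)
import Data.List.Relation.Unary.Unique.Propositional.Properties as Unique
open import Data.Product using (Σ; ∃; _×_; _,_; proj₁; proj₂)
open import Data.Sum using (_⊎_; inj₁; inj₂; [_,_]′)
open import Relation.Nullary.Decidable using (_⊎-dec_; ¬¬-excluded-middle)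
open import Data.Empty using (⊥; ⊥-elim)
open import Relation.Nullary using (¬_; Dec; yes; no; does; ¬?)
open import Relation.Binary.PropositionalEquality
  using (_≡_; _≢_; ≢-sym; refl; cong; cong₂; subst; trans) renaming (sym to ≡-sym)
import Relation.Binary.PropositionalEquality as ≡
open import Function.Bundles using (Equivalence; mk⇔)

module Walks {n : ℕ} (G : Graph n) where

  open import Data.List.Membership.DecPropositional (_≟_ {n}) using (_∈?_)

  adj-sym : ∀ {i j} → Adj G i j → Adj G j i
  adj-sym {i} {j} a = trans (Graph.sym G j i) a

  neighbour-≢ : ∀ {i j} → Adj G i j → j ≢ i
  neighbour-≢ {i} a refl with trans (≡-sym a) (Graph.irrefl G i)
  ... | ()

  -- equal or adjacent: the positions where a matrix in 𝒮(G) may be nonzero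
  Close : Fin n → Fin n → Set
  Close i j = i ≡ j ⊎ Adj G i j

  data WalkIn (P : Fin n → Set) : Fin n → Fin n → Set where
    halt : ∀ {v} → P v → WalkIn P v v
    hop  : ∀ {u v w} → P u → Adj G u v → WalkIn P v w → WalkIn P u w

  module _ {P : Fin n → Set} where

    first-in : ∀ {a b} → WalkIn P a b → P a
    first-in (halt p)    = p
    first-in (hop p _ _) = p

    last-in : ∀ {a b} → WalkIn P a b → P b
    last-in (halt p)    = p
    last-in (hop _ _ W) = last-in W

    _++ʷ_ : ∀ {a b c} → WalkIn P a b → WalkIn P b c → WalkIn P a c
    halt _    ++ʷ W′ = W′
    hop p e W ++ʷ W′ = hop p e (W ++ʷ W′)

    extend : ∀ {a b c} → WalkIn P a b → Adj G b c → P c → WalkIn P a c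
    extend W e pc = W ++ʷ hop (last-in W) e (halt pc)

    reverse : ∀ {a b} → WalkIn P a b → WalkIn P b a
    reverse (halt p)    = halt p
    reverse (hop p e W) = extend (reverse W) (adj-sym e) p

  weaken : ∀ {P Q : Fin n → Set} → (∀ {i} → P i → Q i) → ∀ {a b} → WalkIn P a b → WalkIn Q a b
  weaken f (halt p)    = halt (f p)
  weaken f (hop p e W) = hop (f p) e (weaken f W)

  along : ∀ {P : Fin n → Set} x xs → Path G (x ∷ xs) → All P (x ∷ xs) → WalkIn P x (last x xs)
  along x []       _        (px ∷ []) = halt px
  along x (y ∷ ys) (e , pt) (px ∷ ps) = hop px e (along y ys pt ps)

  record SimplePath (P : Fin n → Set) (p q : Fin n) : Set where
    field
      tail     : List (Fin n)
      path     : Path G (p ∷ tail)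
      distinct : Unique (p ∷ tail)
      inside   : All P (p ∷ tail)
      ends     : last p tail ≡ q

  from-vertex : ∀ {P : Fin n → Set} {u} x xs → u ∈ (x ∷ xs) → Path G (x ∷ xs) → Unique (x ∷ xs) →
                All P (x ∷ xs) → SimplePath P u (last x xs)
  from-vertex x xs       (here refl) pt un al = record { tail = xs ; path = pt ; distinct = un ; inside = al ; ends = refl }
  from-vertex x (y ∷ ys) (there m) (_ , pt) (_ ∷ un) (_ ∷ al) = from-vertex y ys m pt un al

  -- loop erasure: a walk inside P yields a simple path inside P; when the new first vertex
  -- already occurs on the erased rest, the loop up to that occurrence is cut off
  erase : ∀ {P : Fin n → Set} {p q} → WalkIn P p q → SimplePath P p q
  erase (halt pp) = record { tail = [] ; path = _ ; distinct = [] ∷ [] ; inside = pp ∷ [] ; ends = refl }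
  erase {P} {p = u} (hop pu e W) with erase W
  ... | record { tail = tl ; path = pt ; distinct = un ; inside = al ; ends = eq } with u ∈? (_ ∷ tl)
  ...   | yes m = record { SimplePath S ; ends = trans (SimplePath.ends S) eq }
    where
      S : SimplePath P u (last _ tl)
      S = from-vertex _ tl m pt un al
  ...   | no m = record { tail = _ ∷ tl ; path = e , pt ; distinct = ¬Any⇒All¬ _ m ∷ un
                        ; inside = pu ∷ al ; ends = eq }

  first-entry : ∀ {S : Fin n → Set} → (∀ i → Dec (S i)) → ∀ {x y} → Walk G x y → S y →
                S x ⊎ Σ (Fin n) λ t → Σ (Fin n) λ w → ¬ S t × S w × Adj G t w × WalkIn (λ i → ¬ S i) x t
  first-entry S? here        sy = inj₁ sy
  first-entry S? {x} (step e W) sy with S? x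
  ... | yes sx = inj₁ sx
  ... | no ¬sx with first-entry S? W sy
  ...   | inj₁ sv                          = inj₂ (x , _ , ¬sx , sv , e , halt ¬sx)
  ...   | inj₂ (t , w , ¬st , sw , e′ , W′) = inj₂ (t , w , ¬st , sw , e′ , hop ¬sx e W′)

  -- the part of a walk after its last visit to v (if it visits v at all)
  last-exit : ∀ {P : Fin n → Set} v {y t} → WalkIn P y t → t ≢ v →
              (Σ (Fin n) λ u → Adj G v u × WalkIn (λ i → P i × i ≢ v) u t) ⊎
              WalkIn (λ i → P i × i ≢ v) y t
  last-exit v (halt p) t≢v = inj₂ (halt (p , t≢v))
  last-exit v {y} (hop py e W) t≢v with last-exit v W t≢v
  ... | inj₁ exit = inj₁ exit
  ... | inj₂ W′ with y ≟ v
  ...   | yes refl = inj₁ (_ , e , W′)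
  ...   | no y≢v   = inj₂ (hop (py , y≢v) e W′)

  last∈ : ∀ (x : Fin n) xs → last x xs ∈ (x ∷ xs)
  last∈ x []       = here refl
  last∈ x (y ∷ ys) = there (last∈ y ys)

  last-++ : ∀ (x : Fin n) xs y ys → last x (xs ++ y ∷ ys) ≡ last y ys
  last-++ x []       y ys = refl
  last-++ x (z ∷ zs) y ys = last-++ z zs y ys

  path-split : ∀ (x : Fin n) xs y ys → Path G (x ∷ xs ++ y ∷ ys) →
               Path G (x ∷ xs) × Adj G (last x xs) y × Path G (y ∷ ys)
  path-split x []       y ys (e , pt) = _ , e , pt
  path-split x (z ∷ zs) y ys (e , pt) with path-split z zs y ys pt
  ... | p₁ , e′ , p₂ = (e , p₁) , e′ , p₂

  path-join : ∀ (x : Fin n) xs y ys → Path G (x ∷ xs) → Adj G (last x xs) y → Path G (y ∷ ys) →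
              Path G (x ∷ xs ++ y ∷ ys)
  path-join x []       y ys _         e pt = e , pt
  path-join x (z ∷ zs) y ys (e₀ , p₁) e pt = e₀ , path-join z zs y ys p₁ e pt

module Cycles {n : ℕ} (G : Graph n) where
  open Walks G
  import Data.List.Relation.Binary.Permutation.Setoid.Properties (≡.setoid (Fin n)) as Perm

  consec-∈ : ∀ (l : List (Fin n)) {a b} → ConsecIn l a b → a ∈ l × b ∈ l
  consec-∈ (x ∷ y ∷ xs) (inj₁ (inj₁ (refl , refl))) = here refl , there (here refl)
  consec-∈ (x ∷ y ∷ xs) (inj₁ (inj₂ (refl , refl))) = there (here refl) , here refl
  consec-∈ (x ∷ y ∷ xs) (inj₂ c) with consec-∈ (y ∷ xs) c
  ... | ma , mb = there ma , there mb

  edge-on-cycle : (C : Cycle G) → ∀ {a b} → CycleEdge C a b → OnCycle a C × OnCycle b C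
  edge-on-cycle C c with consec-∈ _ c
  ... | ma , mb = on ma , on mb
    where
      on : ∀ {a} → a ∈ (v₀ C ∷ rest C ++ v₀ C ∷ []) → OnCycle a C
      on m with ∈-++⁻ (v₀ C ∷ rest C) m
      ... | inj₁ m′          = m′
      ... | inj₂ (here refl) = here refl

  consec-closing : ∀ (x : Fin n) xs y → ConsecIn (x ∷ xs ++ y ∷ []) y (last x xs)
  consec-closing x []       y = inj₁ (inj₂ (refl , refl))
  consec-closing x (z ∷ zs) y = inj₂ (consec-closing z zs y)

  consec-inner : ∀ {s t : Fin n} x xs → All (_≢ s) (x ∷ xs) → ConsecIn (x ∷ xs ++ s ∷ []) s t →
                 t ≡ last x xs
  consec-inner x []       (nx ∷ [])     (inj₁ (inj₁ (e , _))) = ⊥-elim (nx (≡-sym e))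
  consec-inner x []       (nx ∷ [])     (inj₁ (inj₂ (_ , e))) = e
  consec-inner x (y ∷ ys) (nx ∷ _)      (inj₁ (inj₁ (e , _))) = ⊥-elim (nx (≡-sym e))
  consec-inner x (y ∷ ys) (_ ∷ ny ∷ _)  (inj₁ (inj₂ (e , _))) = ⊥-elim (ny (≡-sym e))
  consec-inner x (y ∷ ys) (_ ∷ al)      (inj₂ c)              = consec-inner y ys al c

  consec-closed : ∀ {s t : Fin n} x xs → All (_≢ s) (x ∷ xs) → ConsecIn (s ∷ x ∷ xs ++ s ∷ []) s t →
                  t ≡ x ⊎ t ≡ last x xs
  consec-closed x xs al       (inj₁ (inj₁ (_ , e))) = inj₁ e
  consec-closed x xs (nx ∷ _) (inj₁ (inj₂ (e , _))) = ⊥-elim (nx (≡-sym e))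
  consec-closed x xs al       (inj₂ c)              = inj₂ (consec-inner x xs al c)

  rotate : (C : Cycle G) → ∀ {w} → OnCycle w C →
           Σ (Cycle G) λ C′ → v₀ C′ ≡ w × (∀ {x} → OnCycle x C′ → OnCycle x C)
  rotate C (here refl) = C , refl , λ m → m
  rotate (cyc c rest len dist pth cl) {w} (there m) with ∈-∃++ m
  ... | pre , post , refl =
    cyc w (post ++ c ∷ pre) length′ distinct′ path′ closes′ , refl , Perm.∈-resp-↭ (Perm.++-comm (w ∷ post) (c ∷ pre))
    where
      halves : Path G (c ∷ pre) × Adj G (last c pre) w × Path G (w ∷ post)
      halves = path-split c pre w post pth
      length′ : 3 ≤ length (w ∷ post ++ c ∷ pre)
      length′ = subst (3 ≤_) (Perm.xs↭ys⇒|xs|≡|ys| (Perm.++-comm (c ∷ pre) (w ∷ post))) len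
      distinct′ : Unique (w ∷ post ++ c ∷ pre)
      distinct′ = Perm.Unique-resp-↭ (Perm.++-comm (c ∷ pre) (w ∷ post)) dist
      path′ : Path G (w ∷ post ++ c ∷ pre)
      path′ = path-join w post c pre (proj₂ (proj₂ halves))
                (subst (λ t → Adj G t c) (last-++ c pre w post) cl) (proj₁ halves)
      closes′ : Adj G (last w (post ++ c ∷ pre)) w
      closes′ = subst (λ t → Adj G t w) (≡-sym (last-++ w post c pre)) (proj₁ (proj₂ halves))

  Detour : Cycle G → Fin n → Set
  Detour C w = Σ (Fin n) λ p → Σ (Fin n) λ q → Adj G w p × Adj G w q × p ≢ q ×
               WalkIn (λ i → OnCycle i C × i ≢ w) p q

  detour-at-start : (C : Cycle G) → Detour C (v₀ C)
  detour-at-start (cyc c (y ∷ z ∷ zs) _ (hc ∷ hy ∷ _) (ecy , pt) cl) =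
    y , last z zs , ecy , adj-sym cl , All.lookup hy (last∈ z zs) ,
    along y (z ∷ zs) pt (All.tabulate λ m → there m , ≢-sym (All.lookup hc m))
  detour-at-start (cyc c []          (s≤s ())       _ _ _)
  detour-at-start (cyc c (y ∷ [])    (s≤s (s≤s ())) _ _ _)

  detour : (C : Cycle G) → ∀ {w} → OnCycle w C → Detour C w
  detour C m with rotate C m
  ... | C′ , refl , back with detour-at-start C′
  ...   | p , q , ep , eq , p≢q , W = p , q , ep , eq , p≢q , weaken (λ (on , ne) → back on , ne) W

  module TheCycle (C : Cycle G) (only-cycle : ∀ (D : Cycle G) → SameCycle C D) where

    record EdgesAt (s p q : Fin n) : Set where
      field
        edge-p : CycleEdge C s p
        edge-q : CycleEdge C s q
        no-other : ∀ t → CycleEdge C s t → t ≡ p ⊎ t ≡ q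

    -- If two distinct neighbours p, q of s are joined by a walk avoiding s, then a simple
    -- such walk closes up with s to a cycle s p … q, which must be C.
    closes-cycle : ∀ {s p q} → Adj G s p → Adj G s q → p ≢ q → WalkIn (_≢ s) p q → EdgesAt s p q
    closes-cycle {s} {p} {q} sp sq p≢q W with erase W
    ... | record { tail = [] ; ends = ends } = ⊥-elim (p≢q ends)
    ... | record { tail = y ∷ ys ; path = pt ; distinct = un ; inside = al ; ends = ends } = record
      { edge-p   = from-D (inj₁ (inj₁ (refl , refl)))
      ; edge-q   = from-D (subst (ConsecIn (s ∷ (p ∷ y ∷ ys) ++ s ∷ []) s) ends
                                 (consec-closing s (p ∷ y ∷ ys) s))
      ; no-other = λ t ce → subst (λ z → t ≡ p ⊎ t ≡ z) ends (consec-closed p (y ∷ ys) al (to-D ce))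
      }
      where
        D : Cycle G
        D = cyc s (p ∷ y ∷ ys) (s≤s (s≤s (s≤s z≤n))) (All.map ≢-sym al ∷ un) (sp , pt)
              (subst (λ z → Adj G z s) (≡-sym ends) (adj-sym sq))
        from-D : ∀ {t} → CycleEdge D s t → CycleEdge C s t
        from-D = Equivalence.from (only-cycle D s _)
        to-D : ∀ {t} → CycleEdge C s t → CycleEdge D s t
        to-D = Equivalence.to (only-cycle D s _)

module Neighbourhoods {n : ℕ} (G : Graph n) where

  record Distinct (k : ℕ) (P : Fin n → Set) : Set where
    field
      elems    : List (Fin n)
      distinct : Unique elems
      valid    : All P elems
      many     : k ≤ length elems

  neighbours : ∀ {k} v → k ≤ degree G v → Distinct k (Adj G v)
  neighbours v k≤d = record
    { elems    = filter adjacent? (allFin n)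
    ; distinct = Unique.filter⁺ adjacent? (Unique.allFin⁺ n)
    ; valid    = all-filter adjacent? (allFin n)
    ; many     = subst (_ ≤_) (count (allFin n)) k≤d
    }
    where
      adjacent? : ∀ u → Dec (Adj G v u)
      adjacent? u = adj G v u Bool.≟ true
      count : ∀ xs → sumℕ (map (λ u → if adj G v u then 1 else 0) xs) ≡ length (filter adjacent? xs)
      count []       = refl
      count (x ∷ xs) with adj G v x
      ... | true  = cong suc (count xs)
      ... | false = count xs

  without : ∀ {k} {P : Fin n → Set} u → Distinct (suc k) P → Distinct k (λ x → P x × x ≢ u)
  without {k} {P} u record { elems = xs ; distinct = un ; valid = al ; many = m } = record
    { elems    = filter ≢u? xs
    ; distinct = Unique.filter⁺ ≢u? un
    ; valid    = All.zip (all-filter⁺ ≢u? al , all-filter ≢u? xs)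
    ; many     = shrink xs un m
    }
    where
      ≢u? : ∀ x → Dec (x ≢ u)
      ≢u? x = ¬? (x ≟ u)
      shrink : ∀ {k} xs → Unique xs → suc k ≤ length xs → k ≤ length (filter ≢u? xs)
      shrink {k} (x ∷ xs) (x∉xs ∷ un) (s≤s m) with x ≟ u
      ... | yes refl = subst (k ≤_) (cong length (≡-sym (filter-all ≢u? (All.map ≢-sym x∉xs)))) m
      ... | no _ with k
      ...   | zero  = z≤n
      ...   | suc k′ = s≤s (shrink xs un m)

  pick-two : ∀ {P : Fin n → Set} → Distinct 2 P → Σ (Fin n) λ a → Σ (Fin n) λ b → P a × P b × a ≢ b
  pick-two record { elems = a ∷ b ∷ _ ; distinct = a∉ ∷ _ ; valid = pa ∷ pb ∷ _ } =
    a , b , pa , pb , All.lookup a∉ (here refl)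
  pick-two record { elems = [] ; many = () }
  pick-two record { elems = _ ∷ [] ; many = s≤s () }

module LinearAlgebra (ℝ : RealField) where
  open RealField ℝ renaming (refl to ≈-refl; sym to ≈-sym; trans to ≈-trans; reflexive to ≈-reflexive)
  open import Relation.Binary.Reasoning.Setoid setoid
  open import Algebra.Properties.Semiring.Sum semiring
    using (sum; sum-cong-≋; sum-replicate-zero; *-distribˡ-sum; *-distribʳ-sum)
  open import Algebra.Properties.Ring ring using (-1*x≈-x; x[y-z]≈xy-xz)
  open import Algebra.Properties.Group +-group using (ε⁻¹≈ε)
  open import Algebra.Properties.CommutativeSemigroup +-commutativeSemigroup using (interchange)

  Σᶠ≡sum : ∀ {n} (f : Fin n → Carrier) → Σᶠ ℝ f ≡ sum f
  Σᶠ≡sum {zero}  f = refl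
  Σᶠ≡sum {suc n} f = cong (f Fin.zero +_) (Σᶠ≡sum (λ i → f (Fin.suc i)))

  sum-zero : ∀ {n} {f : Fin n → Carrier} → (∀ k → f k ≈ 0#) → sum f ≈ 0#
  sum-zero {n} h = ≈-trans (sum-cong-≋ h) (sum-replicate-zero n)

  sum-+ : ∀ {n} (f g : Fin n → Carrier) → sum (λ k → f k + g k) ≈ sum f + sum g
  sum-+ {zero}  f g = ≈-sym (+-identityˡ 0#)
  sum-+ {suc n} f g = ≈-trans (+-congˡ (sum-+ (λ k → f (Fin.suc k)) (λ k → g (Fin.suc k)))) (interchange _ _ _ _)

  sum-neg : ∀ {n} (f : Fin n → Carrier) → sum (λ k → - f k) ≈ - sum f
  sum-neg f = begin
    sum (λ k → - f k)       ≈⟨ sum-cong-≋ (λ k → ≈-sym (-1*x≈-x (f k))) ⟩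
    sum (λ k → - 1# * f k)  ≈⟨ ≈-sym (*-distribˡ-sum (- 1#) f) ⟩
    - 1# * sum f            ≈⟨ -1*x≈-x (sum f) ⟩
    - sum f                 ∎

  sum-single : ∀ {n} (j : Fin n) (f : Fin n → Carrier) → (∀ k → k ≢ j → f k ≈ 0#) → sum f ≈ f j
  sum-single Fin.zero f h =
    ≈-trans (+-congˡ (sum-zero (λ k → h (Fin.suc k) (λ ())))) (+-identityʳ _)
  sum-single (Fin.suc j) f h =
    ≈-trans (+-cong (h Fin.zero (λ ()))
                    (sum-single j _ (λ k k≢j → h (Fin.suc k) (λ e → k≢j (suc-injective e)))))
            (+-identityˡ _)

  _·_ : ∀ {n} → Matrix ℝ n → (Fin n → Carrier) → Fin n → Carrier
  (A · x) i = sum (λ k → A i k * x k)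

  ·-sub : ∀ {n} (A : Matrix ℝ n) (x y : Fin n → Carrier) i →
          (A · (λ k → x k - y k)) i ≈ (A · x) i - (A · y) i
  ·-sub {n} A x y i = begin
    sum (λ k → A i k * (x k - y k))          ≈⟨ sum-cong-≋ (λ k → x[y-z]≈xy-xz (A i k) (x k) (y k)) ⟩
    sum (λ k → A i k * x k - A i k * y k)    ≈⟨ sum-+ {n} _ _ ⟩
    (A · x) i + sum (λ k → - (A i k * y k))  ≈⟨ +-congˡ (sum-neg {n} _) ⟩
    (A · x) i - (A · y) i                    ∎

  ·-sub-null : ∀ {n} (A : Matrix ℝ n) (x y : Fin n → Carrier) i → (A · x) i ≈ (A · y) i →
               (A · (λ k → x k - y k)) i ≈ 0#
  ·-sub-null A x y i eq = ≈-trans (·-sub A x y i) (≈-trans (+-congʳ eq) (-‿inverseʳ _))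

  basis : ∀ {n} → Fin n → Carrier → Fin n → Carrier
  basis i c k = if does (k ≟ i) then c else 0#

  basis-at : ∀ {n} (i : Fin n) c → basis i c i ≈ c
  basis-at i c with i ≟ i
  ... | yes _  = ≈-refl
  ... | no i≢i = ⊥-elim (i≢i refl)

  basis-off : ∀ {n} {i k : Fin n} c → k ≢ i → basis i c k ≈ 0#
  basis-off {i = i} {k} c k≢i with k ≟ i
  ... | yes k≡i = ⊥-elim (k≢i k≡i)
  ... | no _    = ≈-refl

  sum-basis : ∀ {n} (i : Fin n) c → sum (basis i c) ≈ c
  sum-basis i c = ≈-trans (sum-single i (basis i c) (λ k → basis-off c)) (basis-at i c)

  cancel-nonzero : ∀ {a b} → ¬ (a ≈ 0#) → a * b ≈ 0# → b ≈ 0#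
  cancel-nonzero {a} {b} a≉0 ab≈0 with inverse a a≉0
  ... | a⁻¹ , aa⁻¹≈1 = begin
    b              ≈⟨ ≈-sym (*-identityˡ b) ⟩
    1# * b         ≈⟨ *-congʳ (≈-trans (≈-sym aa⁻¹≈1) (*-comm a a⁻¹)) ⟩
    (a⁻¹ * a) * b  ≈⟨ *-assoc a⁻¹ a b ⟩
    a⁻¹ * (a * b)  ≈⟨ *-congˡ ab≈0 ⟩
    a⁻¹ * 0#       ≈⟨ zeroʳ a⁻¹ ⟩
    0#             ∎

  product-nonzero : ∀ {a b} → ¬ (a ≈ 0#) → ¬ (b ≈ 0#) → ¬ (a * b ≈ 0#)
  product-nonzero a≉0 b≉0 ab≈0 = b≉0 (cancel-nonzero a≉0 ab≈0)

  1≉0 : ¬ (1# ≈ 0#)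
  1≉0 e = 0≉1 (≈-sym e)

  -1≉0 : ¬ (- 1# ≈ 0#)
  -1≉0 e = 1≉0 (begin
    1#           ≈⟨ ≈-sym (+-identityʳ 1#) ⟩
    1# + 0#      ≈⟨ +-congˡ (≈-sym e) ⟩
    1# + - 1#    ≈⟨ -‿inverseʳ 1# ⟩
    0#           ∎)

  module NullPair {n : ℕ} (G : Graph n) (A : Matrix ℝ n) (A-sym : Symmetric ℝ A)
                  (off-graph : ∀ i j → i ≢ j → ¬ Adj G i j → A i j ≈ 0#) where

    open Walks G using (Close)

    Null : (Fin n → Carrier) → Set
    Null x = ∀ i → (A · x) i ≈ 0#

    row-combination : ∀ (x y : Fin n → Carrier) i c d →
                      sum (λ k → A i k * (x k * c + y k * d)) ≈ (A · x) i * c + (A · y) i * d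
    row-combination x y i c d = begin
      sum (λ k → A i k * (x k * c + y k * d))                ≈⟨ sum-cong-≋ {n} (λ k → distribˡ (A i k) _ _) ⟩
      sum (λ k → A i k * (x k * c) + A i k * (y k * d))      ≈⟨ sum-+ {n} _ _ ⟩
      sum (λ k → A i k * (x k * c)) + sum (λ k → A i k * (y k * d))
        ≈⟨ +-cong (sum-cong-≋ {n} (λ k → ≈-sym (*-assoc _ _ _)))
                  (sum-cong-≋ {n} (λ k → ≈-sym (*-assoc _ _ _))) ⟩
      sum (λ k → A i k * x k * c) + sum (λ k → A i k * y k * d)
        ≈⟨ +-cong (≈-sym (*-distribʳ-sum {n} c _)) (≈-sym (*-distribʳ-sum {n} d _)) ⟩
      (A · x) i * c + (A · y) i * d                          ∎

    module SymmetricProduct (x y : Fin n → Carrier) (Ax≈0 : Null x) (Ay≈0 : Null y)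
                            (apart : ∀ i j → Close i j → x i * y j ≈ 0#) where

      X : Matrix ℝ n
      X i j = x i * y j + y i * x j

      apart′ : ∀ i j → Close i j → y i * x j ≈ 0#
      apart′ i j (inj₁ refl) = ≈-trans (*-comm (y i) (x i)) (apart i i (inj₁ refl))
      apart′ i j (inj₂ e)    = ≈-trans (*-comm (y i) (x j)) (apart j i (inj₂ (Walks.adj-sym G e)))

      X-close : ∀ i j → Close i j → X i j ≈ 0#
      X-close i j c = ≈-trans (+-cong (apart i j c) (apart′ i j c)) (+-identityˡ 0#)

      X-sym : Symmetric ℝ X
      X-sym i j = ≈-trans (+-cong (*-comm (x i) (y j)) (*-comm (y i) (x j))) (+-comm _ _)

      -- A vanishes where i, j are not close, X where they are
      A∘X : ∀ i j → A i j * X i j ≈ 0#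
      A∘X i j with i ≟ j | adj G i j in e
      ... | yes i≡j | _     = ≈-trans (*-congˡ (X-close i j (inj₁ i≡j))) (zeroʳ _)
      ... | no _    | true  = ≈-trans (*-congˡ (X-close i j (inj₂ e))) (zeroʳ _)
      ... | no i≢j  | false =
            ≈-trans (*-congʳ (off-graph i j i≢j (λ e′ → false≢true (trans (≡-sym e) e′)))) (zeroˡ _)
        where
          false≢true : false ≢ true
          false≢true ()

      AX≈0 : ∀ i j → (_⊗_ ℝ A X) i j ≈ 0#
      AX≈0 i j = begin
        Σᶠ ℝ (λ k → A i k * X k j)                      ≡⟨ Σᶠ≡sum {n} _ ⟩
        sum (λ k → A i k * (x k * y j + y k * x j))    ≈⟨ row-combination x y i (y j) (x j) ⟩
        (A · x) i * y j + (A · y) i * x j              ≈⟨ +-cong (*-congʳ (Ax≈0 i)) (*-congʳ (Ay≈0 i)) ⟩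
        0# * y j + 0# * x j                            ≈⟨ +-cong (zeroˡ _) (zeroˡ _) ⟩
        0# + 0#                                        ≈⟨ +-identityˡ 0# ⟩
        0#                                             ∎

      -- by symmetry of A, XA is computed from the same rows as AX
      XA≈0 : ∀ i j → (_⊗_ ℝ X A) i j ≈ 0#
      XA≈0 i j = begin
        Σᶠ ℝ (λ k → X i k * A k j)                      ≡⟨ Σᶠ≡sum {n} _ ⟩
        sum (λ k → X i k * A k j)                      ≈⟨ sum-cong-≋ {n} transpose ⟩
        sum (λ k → A j k * (y k * x i + x k * y i))    ≈⟨ row-combination y x j (x i) (y i) ⟩
        (A · y) j * x i + (A · x) j * y i              ≈⟨ +-cong (*-congʳ (Ay≈0 j)) (*-congʳ (Ax≈0 j)) ⟩
        0# * x i + 0# * y i                            ≈⟨ +-cong (zeroˡ _) (zeroˡ _) ⟩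
        0# + 0#                                        ≈⟨ +-identityˡ 0# ⟩
        0#                                             ∎
        where
          transpose : ∀ k → X i k * A k j ≈ A j k * (y k * x i + x k * y i)
          transpose k = ≈-trans (*-comm _ _)
            (*-cong (A-sym k j) (+-cong (*-comm (x i) (y k)) (*-comm (y i) (x k))))

      SSP⇒X≈0 : SSP ℝ A → ∀ i j → X i j ≈ 0#
      SSP⇒X≈0 ssp = ssp X X-sym A∘X (λ i → X-close i i (inj₁ refl))
                        (λ i j → ≈-trans (AX≈0 i j) (≈-sym (XA≈0 i j)))

    -- The obstruction: the SSP forces X = 0, yet if x i₀ ≠ 0 ≠ y j₀ then y i₀ = 0 (as
    -- x i₀ y i₀ = 0), so X i₀ j₀ = x i₀ y j₀ ≠ 0.
    null-pair-violates-SSP : ∀ (x y : Fin n → Carrier) → Null x → Null y →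
                             (∀ i j → Close i j → x i * y j ≈ 0#) →
                             ∀ i₀ j₀ → ¬ (x i₀ ≈ 0#) → ¬ (y j₀ ≈ 0#) → ¬ SSP ℝ A
    null-pair-violates-SSP x y Ax≈0 Ay≈0 apart i₀ j₀ xi₀≉0 yj₀≉0 ssp =
      product-nonzero xi₀≉0 yj₀≉0 (begin
        x i₀ * y j₀                ≈⟨ ≈-sym (+-identityʳ _) ⟩
        x i₀ * y j₀ + 0#           ≈⟨ +-congˡ (≈-sym (≈-trans (*-congʳ yi₀≈0) (zeroˡ _))) ⟩
        x i₀ * y j₀ + y i₀ * x j₀  ≈⟨ SSP⇒X≈0 ssp i₀ j₀ ⟩
        0#                         ∎)
      where
        open SymmetricProduct x y Ax≈0 Ay≈0 apart
        yi₀≈0 : y i₀ ≈ 0#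
        yi₀≈0 = cancel-nonzero xi₀≉0 (apart i₀ i₀ (inj₁ refl))

    record Witness (Support : Fin n → Set) : Set where
      field
        vec      : Fin n → Carrier
        null     : Null vec
        support? : ∀ i → Dec (Support i)
        outside  : ∀ i → ¬ Support i → vec i ≈ 0#
        point    : Fin n
        nonzero  : ¬ (vec point ≈ 0#)

    witnesses-violate-SSP : ∀ {P Q : Fin n → Set} → Witness P → Witness Q →
                            (∀ i j → Close i j → P i → Q j → ⊥) → ¬ SSP ℝ A
    witnesses-violate-SSP x y far =
      null-pair-violates-SSP (vec x) (vec y) (null x) (null y) apart (point x) (point y) (nonzero x) (nonzero y)
      where
        open Witness
        apart : ∀ i j → Close i j → vec x i * vec y j ≈ 0#
        apart i j c with support? x i
        ... | no ¬pi = ≈-trans (*-congʳ (outside x i ¬pi)) (zeroˡ _)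
        ... | yes pi = ≈-trans (*-congˡ (outside y j (far i j c pi))) (zeroʳ _)

  -- The vertices v and w (possibly equal) are special,
  -- all others are inner.  An edge between inner vertices gets weight 1; an edge s–k at a
  -- special vertex s gets weight sign s k, which is −1 exactly for the edge w–q.  The
  -- diagonal is 0 at special vertices and minus the number of inner neighbours at inner
  -- ones, so on inner vertices A acts like minus the Laplacian of G − {v, w}.
  module Construction {n : ℕ} (G : Graph n) (v w q : Fin n) where
    open Walks G

    Special Inner : Fin n → Set
    Special i = i ≡ v ⊎ i ≡ w
    Inner i = i ≢ v × i ≢ w

    special? : Fin n → Bool
    special? i = does (i ≟ v) ∨ does (i ≟ w)

    classify : ∀ i → (special? i ≡ true × Special i) ⊎ (special? i ≡ false × Inner i)
    classify i with i ≟ v | i ≟ w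
    ... | yes i≡v | _       = inj₁ (refl , inj₁ i≡v)
    ... | no _    | yes i≡w = inj₁ (refl , inj₂ i≡w)
    ... | no i≢v  | no i≢w  = inj₂ (refl , i≢v , i≢w)

    special-not-inner : ∀ {i} → Special i → ¬ Inner i
    special-not-inner (inj₁ i≡v) (i≢v , _) = i≢v i≡v
    special-not-inner (inj₂ i≡w) (_ , i≢w) = i≢w i≡w

    special-true : ∀ {i} → Special i → special? i ≡ true
    special-true {i} si with classify i
    ... | inj₁ (e , _)  = e
    ... | inj₂ (_ , ni) = ⊥-elim (special-not-inner si ni)

    inner-false : ∀ {i} → Inner i → special? i ≡ false
    inner-false {i} ni with classify i
    ... | inj₁ (_ , si) = ⊥-elim (special-not-inner si ni)
    ... | inj₂ (e , _)  = e

    sign : Fin n → Fin n → Carrier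
    sign s k = if does (s ≟ w) ∧ does (k ≟ q) then - 1# else 1#

    sign-positive : ∀ {s k} → (s ≢ w ⊎ k ≢ q) → sign s k ≈ 1#
    sign-positive {s} {k} h with s ≟ w | k ≟ q
    ... | no _    | _       = ≈-refl
    ... | yes _   | no _    = ≈-refl
    ... | yes s≡w | yes k≡q with h
    ...   | inj₁ s≢w = ⊥-elim (s≢w s≡w)
    ...   | inj₂ k≢q = ⊥-elim (k≢q k≡q)

    sign-negative : sign w q ≈ - 1#
    sign-negative with w ≟ w | q ≟ q
    ... | yes _ | yes _ = ≈-refl
    ... | no w≢w | _    = ⊥-elim (w≢w refl)
    ... | yes _ | no q≢q = ⊥-elim (q≢q refl)

    sign-nonzero : ∀ s k → ¬ (sign s k ≈ 0#)
    sign-nonzero s k with does (s ≟ w) ∧ does (k ≟ q)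
    ... | true  = -1≉0
    ... | false = 1≉0

    weight : Fin n → Fin n → Carrier
    weight i k = if special? i then sign i k else 1#

    inner-indicator : Fin n → Carrier
    inner-indicator k = if special? k then 0# else 1#

    inner-degree : Fin n → Carrier
    inner-degree i = sum (λ k → if adj G i k then inner-indicator k else 0#)

    diagonal : Fin n → Carrier
    diagonal i = if special? i then 0# else - inner-degree i

    off-diagonal : Fin n → Fin n → Carrier
    off-diagonal i j = if adj G i j then weight i j * weight j i else 0#

    A : Matrix ℝ n
    A i j = if does (i ≟ j) then diagonal i else off-diagonal i j

    A-diag : ∀ i → A i i ≡ diagonal i
    A-diag i with i ≟ i
    ... | yes _  = refl
    ... | no i≢i = ⊥-elim (i≢i refl)

    A-off : ∀ {i j} → i ≢ j → A i j ≡ off-diagonal i j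
    A-off {i} {j} i≢j with i ≟ j
    ... | yes i≡j = ⊥-elim (i≢j i≡j)
    ... | no _    = refl

    A-sym : Symmetric ℝ A
    A-sym i j with i ≟ j
    ... | yes refl = ≈-reflexive (≡-sym (A-diag i))
    ... | no i≢j rewrite A-off (≢-sym i≢j) | Graph.sym G i j with adj G j i
    ...   | true  = *-comm _ _
    ...   | false = ≈-refl

    A-off-graph : ∀ i j → i ≢ j → ¬ Adj G i j → A i j ≈ 0#
    A-off-graph i j i≢j ¬e rewrite A-off i≢j with adj G i j
    ... | true  = ⊥-elim (¬e refl)
    ... | false = ≈-refl

    weight-nonzero : ∀ s k → ¬ (weight s k ≈ 0#)
    weight-nonzero s k with special? s
    ... | true  = sign-nonzero s k
    ... | false = 1≉0

    A∈𝒮 : InS ℝ G A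
    A∈𝒮 = A-sym , λ i j i≢j → mk⇔ (nonzero⇒edge i j i≢j) (edge⇒nonzero i j i≢j)
      where
        nonzero⇒edge : ∀ i j → i ≢ j → ¬ (A i j ≈ 0#) → Adj G i j
        nonzero⇒edge i j i≢j h rewrite A-off i≢j with adj G i j
        ... | true  = refl
        ... | false = ⊥-elim (h ≈-refl)
        edge⇒nonzero : ∀ i j → i ≢ j → Adj G i j → ¬ (A i j ≈ 0#)
        edge⇒nonzero i j i≢j e rewrite A-off i≢j | e = product-nonzero (weight-nonzero i j) (weight-nonzero j i)

    inner-row-sum : ∀ {i} → Inner i → sum (λ k → A i k * inner-indicator k) ≈ 0#
    inner-row-sum {i} ni = begin
      sum (λ k → A i k * inner-indicator k)           ≈⟨ sum-cong-≋ {n} entry ⟩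
      sum (λ k → neighbour k + basis i (- d) k)       ≈⟨ sum-+ {n} _ _ ⟩
      d + sum (basis i (- d))                         ≈⟨ +-congˡ (sum-basis i (- d)) ⟩
      d - d                                           ≈⟨ -‿inverseʳ d ⟩
      0#                                              ∎
      where
        neighbour : Fin n → Carrier
        neighbour k = if adj G i k then inner-indicator k else 0#
        d : Carrier
        d = inner-degree i
        entry : ∀ k → A i k * inner-indicator k ≈ neighbour k + basis i (- d) k
        entry k with k ≟ i
        ... | yes refl rewrite A-diag k | inner-false ni | Graph.irrefl G k =
              ≈-trans (*-identityʳ _) (≈-sym (+-identityˡ _))
        ... | no k≢i rewrite A-off (≢-sym k≢i) with adj G i k
        ...   | false = ≈-trans (zeroˡ _) (≈-sym (+-identityˡ 0#))
        ...   | true rewrite inner-false ni with special? k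
        ...     | true  = ≈-trans (zeroʳ _) (≈-sym (+-identityʳ 0#))
        ...     | false = ≈-trans (*-identityʳ _) (≈-trans (*-identityˡ 1#) (≈-sym (+-identityʳ 1#)))

    -- reachability inside the inner vertices: the components of G − {v, w}
    Reach : Fin n → Fin n → Set
    Reach = WalkIn Inner

    components-apart : ∀ {a c i j} → ¬ Reach a c → Close i j → Reach a i → Reach c j → ⊥
    components-apart ¬ac (inj₁ refl) ai cj = ¬ac (ai ++ʷ reverse cj)
    components-apart ¬ac (inj₂ e)    ai cj = ¬ac (extend ai e (last-in cj) ++ʷ reverse cj)

    attach : Fin n → Fin n → Carrier
    attach s k = if adj G s k then sign s k else 0#

    -- Components are only decidable classically, which suffices as the theorem is a negation.
    module Components (reach? : ∀ a k → Dec (Reach a k)) where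

      indicator : Fin n → Fin n → Carrier
      indicator a k = if does (reach? a k) then 1# else 0#

      indicator-in : ∀ {a k} → Reach a k → indicator a k ≈ 1#
      indicator-in {a} {k} r with reach? a k
      ... | yes _ = ≈-refl
      ... | no ¬r = ⊥-elim (¬r r)

      indicator-out : ∀ {a k} → ¬ Reach a k → indicator a k ≈ 0#
      indicator-out {a} {k} ¬r with reach? a k
      ... | yes r = ⊥-elim (¬r r)
      ... | no _  = ≈-refl

      indicator-special : ∀ a {k} → Special k → indicator a k ≈ 0#
      indicator-special a sk = indicator-out (λ r → special-not-inner sk (last-in r))

      indicator-edge : ∀ a {i k} → Inner i → Inner k → Adj G i k → indicator a i ≈ indicator a k
      indicator-edge a {i} {k} ni nk e with reach? a i | reach? a k
      ... | yes _  | yes _  = ≈-refl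
      ... | no _   | no _   = ≈-refl
      ... | yes ri | no ¬rk = ⊥-elim (¬rk (extend ri e nk))
      ... | no ¬ri | yes rk = ⊥-elim (¬ri (extend rk (adj-sym e) ni))

      inner-row-null : ∀ a {i} → Inner i → (A · indicator a) i ≈ 0#
      inner-row-null a {i} ni = begin
        sum (λ k → A i k * indicator a k)                          ≈⟨ sum-cong-≋ {n} entry ⟩
        sum (λ k → A i k * inner-indicator k * indicator a i)      ≈⟨ ≈-sym (*-distribʳ-sum {n} _ _) ⟩
        sum (λ k → A i k * inner-indicator k) * indicator a i      ≈⟨ *-congʳ (inner-row-sum ni) ⟩
        0# * indicator a i                                          ≈⟨ zeroˡ _ ⟩
        0#                                                          ∎
        where
          entry : ∀ k → A i k * indicator a k ≈ A i k * inner-indicator k * indicator a i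
          entry k with k ≟ i
          ... | yes refl rewrite inner-false ni = *-congʳ (≈-sym (*-identityʳ _))
          ... | no k≢i rewrite A-off (≢-sym k≢i) with classify k
          ...   | inj₁ (e , sk) rewrite e =
                  ≈-trans (*-congˡ (indicator-special a sk))
                          (≈-trans (zeroʳ _) (≈-sym (≈-trans (*-congʳ (zeroʳ _)) (zeroˡ _))))
          ...   | inj₂ (e , nk) rewrite e with adj G i k in eik
          ...     | false = ≈-trans (zeroˡ _) (≈-sym (≈-trans (*-congʳ (zeroˡ _)) (zeroˡ _)))
          ...     | true  = *-cong (≈-sym (*-identityʳ _)) (≈-sym (indicator-edge a ni nk eik))

      special-entry : ∀ {s} → Special s → ∀ a k → A s k * indicator a k ≈ attach s k * indicator a k
      special-entry {s} ss a k with k ≟ s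
      ... | yes refl rewrite A-diag k | special-true ss | Graph.irrefl G k = ≈-refl
      ... | no k≢s rewrite A-off (≢-sym k≢s) with adj G s k
      ...   | false = ≈-refl
      ...   | true with classify k
      ...     | inj₁ (_ , sk) = ≈-trans (*-congˡ z≈0) (≈-trans (zeroʳ _) (≈-sym (≈-trans (*-congˡ z≈0) (zeroʳ _))))
        where
          z≈0 : indicator a k ≈ 0#
          z≈0 = indicator-special a sk
      ...     | inj₂ (e , _) rewrite e | special-true ss = *-congʳ (*-identityʳ _)

      row-detached : ∀ {s a} → Special s → (∀ k → Adj G s k → ¬ Reach a k) → (A · indicator a) s ≈ 0#
      row-detached {s} {a} ss none = ≈-trans (sum-cong-≋ {n} (special-entry ss a)) (sum-zero entry)
        where
          entry : ∀ k → attach s k * indicator a k ≈ 0#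
          entry k with adj G s k in e
          ... | false = zeroˡ _
          ... | true  = ≈-trans (*-congˡ (indicator-out (none k e))) (zeroʳ _)

      row-single : ∀ {s a} → Special s → Inner a → (∀ k → Adj G s k → Reach a k → k ≡ a) →
                   (A · indicator a) s ≈ attach s a
      row-single {s} {a} ss na only = begin
        sum (λ k → A s k * indicator a k)       ≈⟨ sum-cong-≋ {n} (special-entry ss a) ⟩
        sum (λ k → attach s k * indicator a k)  ≈⟨ sum-single a _ entry ⟩
        attach s a * indicator a a              ≈⟨ *-congˡ (indicator-in (halt na)) ⟩
        attach s a * 1#                         ≈⟨ *-identityʳ _ ⟩
        attach s a                              ∎
        where
          entry : ∀ k → k ≢ a → attach s k * indicator a k ≈ 0#
          entry k k≢a with adj G s k in e
          ... | false = zeroˡ _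
          ... | true  = ≈-trans (*-congˡ (indicator-out (λ r → k≢a (only k e r)))) (zeroʳ _)

      row-double : ∀ {s p q} → Special s → Inner p → Reach p q → p ≢ q →
                   (∀ k → Adj G s k → Reach p k → k ≡ p ⊎ k ≡ q) →
                   (A · indicator p) s ≈ attach s p + attach s q
      row-double {s} {p} {q} ss np pq p≢q only = begin
        sum (λ k → A s k * indicator p k)                      ≈⟨ sum-cong-≋ {n} (special-entry ss p) ⟩
        sum (λ k → attach s k * indicator p k)                 ≈⟨ sum-cong-≋ {n} entry ⟩
        sum (λ k → basis p (attach s p) k + basis q (attach s q) k) ≈⟨ sum-+ {n} _ _ ⟩
        sum (basis p (attach s p)) + sum (basis q (attach s q))    ≈⟨ +-cong (sum-basis p _) (sum-basis q _) ⟩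
        attach s p + attach s q                                ∎
        where
          entry : ∀ k → attach s k * indicator p k ≈ basis p (attach s p) k + basis q (attach s q) k
          entry k with k ≟ p | k ≟ q
          ... | yes refl | yes refl = ⊥-elim (p≢q refl)
          ... | yes refl | no _ =
                ≈-trans (*-congˡ (indicator-in (halt np))) (≈-trans (*-identityʳ _) (≈-sym (+-identityʳ _)))
          ... | no _ | yes refl =
                ≈-trans (*-congˡ (indicator-in pq)) (≈-trans (*-identityʳ _) (≈-sym (+-identityˡ _)))
          ... | no k≢p | no k≢q with adj G s k in e
          ...   | false = ≈-trans (zeroˡ _) (≈-sym (+-identityˡ 0#))
          ...   | true  = ≈-trans (*-congˡ (indicator-out (λ r → neither (only k e r))))
                                  (≈-trans (zeroʳ _) (≈-sym (+-identityˡ 0#)))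
            where
              neither : ¬ (k ≡ p ⊎ k ≡ q)
              neither (inj₁ k≡p) = k≢p k≡p
              neither (inj₂ k≡q) = k≢q k≡q

      open NullPair G A A-sym A-off-graph using (Null; Witness; witnesses-violate-SSP)

      difference-outside : ∀ a b i → ¬ (Reach a i ⊎ Reach b i) → indicator a i - indicator b i ≈ 0#
      difference-outside a b i ¬r = begin
        indicator a i - indicator b i  ≈⟨ +-cong (indicator-out (λ r → ¬r (inj₁ r)))
                                                 (-‿cong (indicator-out (λ r → ¬r (inj₂ r)))) ⟩
        0# - 0#                        ≈⟨ -‿inverseʳ 0# ⟩
        0#                             ∎

      record Pendant (s a : Fin n) : Set where
        field
          special  : Special s
          inner    : Inner a
          edge     : Adj G s a
          positive : sign s a ≈ 1#
          only     : ∀ {s′ k} → Special s′ → Adj G s′ k → Reach a k → s′ ≡ s × k ≡ a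

      pendant-row : ∀ {s a s′} → Pendant s a → Special s′ → (A · indicator a) s′ ≈ basis s 1# s′
      pendant-row {s} {a} {s′} P ss′ with s′ ≟ s
      ... | yes refl = begin
        (A · indicator a) s  ≈⟨ row-single ss′ (Pendant.inner P) (λ k e r → proj₂ (Pendant.only P ss′ e r)) ⟩
        attach s a           ≡⟨ cong (λ b → if b then sign s a else 0#) (Pendant.edge P) ⟩
        sign s a             ≈⟨ Pendant.positive P ⟩
        1#                   ∎
      ... | no s′≢s = row-detached ss′ (λ k e r → s′≢s (proj₁ (Pendant.only P ss′ e r)))

      pendant-pair : ∀ {s a b} → Pendant s a → Pendant s b → ¬ Reach b a →
                     Witness (λ i → Reach a i ⊎ Reach b i)
      pendant-pair {s} {a} {b} Pa Pb ¬ba = record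
        { vec      = λ k → indicator a k - indicator b k
        ; null     = null
        ; support? = λ i → reach? a i ⊎-dec reach? b i
        ; outside  = difference-outside a b
        ; point    = a
        ; nonzero  = λ e → 1≉0 (≈-trans (≈-sym at-a) e)
        }
        where
          null : Null (λ k → indicator a k - indicator b k)
          null i with classify i
          ... | inj₁ (_ , si) = ·-sub-null A _ _ i (≈-trans (pendant-row Pa si) (≈-sym (pendant-row Pb si)))
          ... | inj₂ (_ , ni) = ·-sub-null A _ _ i (≈-trans (inner-row-null a ni) (≈-sym (inner-row-null b ni)))
          at-a : indicator a a - indicator b a ≈ 1#
          at-a = begin
            indicator a a - indicator b a  ≈⟨ +-cong (indicator-in (halt (Pendant.inner Pa)))
                                                     (-‿cong (indicator-out ¬ba)) ⟩
            1# - 0#                        ≈⟨ +-congˡ ε⁻¹≈ε ⟩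
            1# + 0#                        ≈⟨ +-identityʳ 1# ⟩
            1#                             ∎

      record Balanced (p : Fin n) : Set where
        field
          inner  : Inner p
          edge-p : Adj G w p
          edge-q : Adj G w q
          p≢q    : p ≢ q
          linked : Reach p q
          only   : ∀ {s k} → Special s → Adj G s k → Reach p k → s ≡ w × (k ≡ p ⊎ k ≡ q)

      balanced-row : ∀ {p s} → Balanced p → Special s → (A · indicator p) s ≈ 0#
      balanced-row {p} {s} B ss = by-cases (s ≟ w)
        where
          open Balanced B
          at-w : (A · indicator p) w ≈ 0#
          at-w = begin
            (A · indicator p) w      ≈⟨ row-double (inj₂ refl) inner linked p≢q
                                                   (λ k e r → proj₂ (only (inj₂ refl) e r)) ⟩
            attach w p + attach w q  ≡⟨ cong₂ (λ b c → (if b then sign w p else 0#) + (if c then sign w q else 0#))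
                                              edge-p edge-q ⟩
            sign w p + sign w q      ≈⟨ +-cong (sign-positive {w} (inj₂ p≢q)) sign-negative ⟩
            1# - 1#                  ≈⟨ -‿inverseʳ 1# ⟩
            0#                       ∎
          by-cases : Dec (s ≡ w) → (A · indicator p) s ≈ 0#
          by-cases (yes s≡w) = subst (λ t → (A · indicator p) t ≈ 0#) (≡-sym s≡w) at-w
          by-cases (no s≢w)  = row-detached ss (λ k e r → s≢w (proj₁ (only ss e r)))

      balanced : ∀ {p} → Balanced p → Witness (Reach p)
      balanced {p} B = record
        { vec      = indicator p
        ; null     = null
        ; support? = reach? p
        ; outside  = λ i → indicator-out
        ; point    = p
        ; nonzero  = λ e → 1≉0 (≈-trans (≈-sym (indicator-in (halt (Balanced.inner B)))) e)
        }
        where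
          null : Null (indicator p)
          null i with classify i
          ... | inj₁ (_ , si) = balanced-row B si
          ... | inj₂ (_ , ni) = inner-row-null p ni

      two-pendant-pairs : ∀ {s a b s′ c d} → Pendant s a → Pendant s b → ¬ Reach b a →
                          Pendant s′ c → Pendant s′ d → ¬ Reach d c →
                          ¬ Reach a c → ¬ Reach a d → ¬ Reach b c → ¬ Reach b d → ¬ SSP ℝ A
      two-pendant-pairs {_} {a} {b} {_} {c} {d} Pa Pb ¬ba Pc Pd ¬dc ¬ac ¬ad ¬bc ¬bd =
        witnesses-violate-SSP (pendant-pair Pa Pb ¬ba) (pendant-pair Pc Pd ¬dc) far
        where
          far : ∀ i j → Close i j → Reach a i ⊎ Reach b i → Reach c j ⊎ Reach d j → ⊥
          far i j cl (inj₁ ai) (inj₁ cj) = components-apart ¬ac cl ai cj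
          far i j cl (inj₁ ai) (inj₂ dj) = components-apart ¬ad cl ai dj
          far i j cl (inj₂ bi) (inj₁ cj) = components-apart ¬bc cl bi cj
          far i j cl (inj₂ bi) (inj₂ dj) = components-apart ¬bd cl bi dj

      pendant-pair-and-balanced : ∀ {s a b p} → Pendant s a → Pendant s b → ¬ Reach b a →
                                  Balanced p → ¬ Reach a p → ¬ Reach b p → ¬ SSP ℝ A
      pendant-pair-and-balanced {_} {a} {b} {p} Pa Pb ¬ba Bp ¬ap ¬bp =
        witnesses-violate-SSP (pendant-pair Pa Pb ¬ba) (balanced Bp) far
        where
          far : ∀ i j → Close i j → Reach a i ⊎ Reach b i → Reach p j → ⊥
          far i j cl (inj₁ ai) pj = components-apart ¬ap cl ai pj
          far i j cl (inj₂ bi) pj = components-apart ¬bp cl bi pj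

-- Finitely many instances of excluded middle may be assumed at once when proving a negation.
¬¬-∀ : ∀ {n} (Q : Fin n → Set) → (∀ i → ¬ ¬ Q i) → ¬ ¬ (∀ i → Q i)
¬¬-∀ {zero}  Q h k = k (λ ())
¬¬-∀ {suc n} Q h k = h Fin.zero λ q₀ →
  ¬¬-∀ (λ i → Q (Fin.suc i)) (λ i → h (Fin.suc i)) λ qs → k λ { Fin.zero → q₀ ; (Fin.suc i) → qs i }

¬¬-decide : ∀ {n} (P : Fin n → Fin n → Set) → ¬ ¬ (∀ a k → Dec (P a k))
¬¬-decide P = ¬¬-∀ _ (λ a → ¬¬-∀ _ (λ k → ¬¬-excluded-middle))

module Cases (ℝ : RealField) {n : ℕ} (G : Graph n) (C : Cycle G)
             (only-cycle : ∀ (D : Cycle G) → SameCycle C D) where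
  open Walks G
  open Cycles G
  open TheCycle C only-cycle
  open Neighbourhoods G
  open LinearAlgebra ℝ using (module Construction)

  Lonely : Fin n → Fin n → Set
  Lonely v a = ∀ {k} → Adj G v k → k ≢ a → ¬ WalkIn (_≢ v) a k

  on≢off : ∀ {x y} → OnCycle x C → ¬ OnCycle y C → x ≢ y
  on≢off x-on y-off x≡y = y-off (subst (λ z → OnCycle z C) x≡y x-on)

  lonely : ∀ {v a} → Adj G v a → ¬ CycleEdge C v a → Lonely v a
  lonely va ¬cycle vk k≢a W = ¬cycle (EdgesAt.edge-p (closes-cycle va vk (≢-sym k≢a) W))

  -- Case 1: a vertex v of degree at least four.  Take v = w as the only special vertex.
  module HighDegree (v : Fin n) (deg≥4 : 4 ≤ degree G v) (H : InGSSP ℝ G) where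

    Linked : Set
    Linked = Σ (Fin n) λ p → Σ (Fin n) λ q → Adj G v p × Adj G v q × p ≢ q × WalkIn (_≢ v) p q

    module At (q : Fin n) (reach? : ∀ a k → Dec (WalkIn (λ i → i ≢ v × i ≢ v) a k)) where
      open Construction G v v q public
      open Components reach? public

      avoids-v : ∀ {a k} → Reach a k → WalkIn (_≢ v) a k
      avoids-v = weaken proj₁

      neighbour-inner : ∀ {a} → Adj G v a → Inner a
      neighbour-inner va = neighbour-≢ va , neighbour-≢ va

      pendant : ∀ {a} → Adj G v a → a ≢ q → Lonely v a → Pendant v a
      pendant {a} va a≢q lonely-a = record
        { special = inj₁ refl ; inner = neighbour-inner va ; edge = va
        ; positive = sign-positive {v} (inj₂ a≢q) ; only = only }
        where
          only : ∀ {s k} → Special s → Adj G s k → Reach a k → s ≡ v × k ≡ a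
          only (inj₁ refl) vk r with _ ≟ a
          ... | yes k≡a = refl , k≡a
          ... | no k≢a  = ⊥-elim (lonely-a vk k≢a (avoids-v r))
          only (inj₂ refl) vk r = only (inj₁ refl) vk r

      separate : ∀ {a b} → Adj G v b → b ≢ a → Lonely v a → ¬ Reach a b
      separate vb b≢a lonely-a r = lonely-a vb b≢a (avoids-v r)

      balanced-at : ∀ {p} → Adj G v p → Adj G v q → p ≢ q → WalkIn (_≢ v) p q → EdgesAt v p q → Balanced p
      balanced-at {p} vp vq p≢q W edges = record
        { inner = neighbour-inner vp ; edge-p = vp ; edge-q = vq ; p≢q = p≢q
        ; linked = weaken (λ i≢v → i≢v , i≢v) W ; only = only }
        where
          only : ∀ {s k} → Special s → Adj G s k → Reach p k → s ≡ v × (k ≡ p ⊎ k ≡ q)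
          only (inj₁ refl) vk r with _ ≟ p
          ... | yes k≡p = refl , inj₁ k≡p
          ... | no k≢p  = refl , EdgesAt.no-other edges _
                                   (EdgesAt.edge-q (closes-cycle vp vk (≢-sym k≢p) (avoids-v r)))
          only (inj₂ refl) vk r = only (inj₁ refl) vk r

    -- Case 1a: no two neighbours of v are linked; four of them give two pendant pairs.
    unlinked : ¬ Linked → ⊥
    unlinked ¬linked with pick-two (neighbours v (≤-trans (s≤s (s≤s z≤n)) deg≥4))
    ... | a , b , va , vb , a≢b with pick-two (without b (without a (neighbours v deg≥4)))
    ...   | c , d , ((vc , c≢a) , c≢b) , ((vd , d≢a) , d≢b) , c≢d =
      ¬¬-decide _ λ reach? → let open At v reach? in
        two-pendant-pairs (pendant va (neighbour-≢ va) (all-lonely va)) (pendant vb (neighbour-≢ vb) (all-lonely vb))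
          (separate va a≢b (all-lonely vb))
          (pendant vc (neighbour-≢ vc) (all-lonely vc)) (pendant vd (neighbour-≢ vd) (all-lonely vd))
          (separate vc c≢d (all-lonely vd))
          (separate vc c≢a (all-lonely va)) (separate vd d≢a (all-lonely va))
          (separate vc c≢b (all-lonely vb)) (separate vd d≢b (all-lonely vb))
          (H A A∈𝒮)
      where
        all-lonely : ∀ {x} → Adj G v x → Lonely v x
        all-lonely {x} vx vk k≢x W = ¬linked (x , _ , vx , vk , ≢-sym k≢x , W)

    -- Case 1b: neighbours p, q of v are linked, so v–p and v–q are the cycle edges at v.
    -- Making v–q the negative edge, the component of p is balanced, and two further
    -- neighbours of v are lonely and give a pendant pair.
    linked : Linked → ⊥
    linked (p , q , vp , vq , p≢q , W) with pick-two (without q (without p (neighbours v deg≥4)))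
    ... | a , b , ((va , a≢p) , a≢q) , ((vb , b≢p) , b≢q) , a≢b =
      ¬¬-decide _ λ reach? → let open At q reach? in
        pendant-pair-and-balanced (pendant va a≢q (off-cycle va a≢p a≢q)) (pendant vb b≢q (off-cycle vb b≢p b≢q))
          (separate va a≢b (off-cycle vb b≢p b≢q)) (balanced-at vp vq p≢q W edges)
          (separate vp (≢-sym a≢p) (off-cycle va a≢p a≢q))
          (separate vp (≢-sym b≢p) (off-cycle vb b≢p b≢q))
          (H A A∈𝒮)
      where
        edges : EdgesAt v p q
        edges = closes-cycle vp vq p≢q W
        off-cycle : ∀ {x} → Adj G v x → x ≢ p → x ≢ q → Lonely v x
        off-cycle vx x≢p x≢q = lonely vx λ ce → [ x≢p , x≢q ]′ (EdgesAt.no-other edges _ ce)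

    high-degree : ⊥
    high-degree = ¬¬-excluded-middle λ { (yes l) → linked l ; (no ¬l) → unlinked ¬l }

  -- Case 2: a vertex v of degree three off the cycle.  Take v and the first cycle vertex w
  -- on a walk from v as special vertices.
  module OffCycle (v : Fin n) (v-off : ¬ OnCycle v C) (deg≡3 : degree G v ≡ 3)
                  (connected : Connected G) (H : InGSSP ℝ G) where
    open import Data.List.Membership.DecPropositional (_≟_ {n}) using (_∈?_)

    -- v lies on no cycle edge, so its neighbours are pairwise unlinked
    lonely-v : ∀ {a} → Adj G v a → Lonely v a
    lonely-v va = lonely va (λ ce → v-off (proj₁ (edge-on-cycle C ce)))

    record Approach : Set where
      field
        w     : Fin n
        w-on  : OnCycle w C
        u     : Fin n
        vu    : Adj G v u
        route : u ≡ w ⊎ Σ (Fin n) λ t → ¬ OnCycle t C × Adj G t w ×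
                                         WalkIn (λ i → ¬ OnCycle i C × i ≢ v) u t

    -- follow a walk from v to the cycle up to its first cycle vertex, after its last visit to v
    approach : Approach
    approach with first-entry (λ i → i ∈? (v₀ C ∷ rest C)) (connected v (v₀ C)) (here refl)
    ... | inj₁ v-on = ⊥-elim (v-off v-on)
    ... | inj₂ (t , w , t-off , w-on , tw , W) with t ≟ v
    ...   | yes refl = record { w = w ; w-on = w-on ; u = w ; vu = tw ; route = inj₁ refl }
    ...   | no t≢v with last-exit v W t≢v
    ...     | inj₁ (u , vu , W′) =
              record { w = w ; w-on = w-on ; u = u ; vu = vu ; route = inj₂ (t , t-off , tw , W′) }
    ...     | inj₂ W′            = ⊥-elim (proj₂ (first-in W′) refl)

    open Approach approach

    w≢v : w ≢ v
    w≢v = on≢off w-on v-off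

    towards-u : ∀ {y} → WalkIn (_≢ v) y w → WalkIn (_≢ v) y u
    towards-u W with route
    ... | inj₁ u≡w                   = subst (WalkIn _ _) (≡-sym u≡w) W
    ... | inj₂ (t , t-off , tw , W′) = W ++ʷ hop w≢v (adj-sym tw) (reverse (weaken proj₂ W′))

    -- a cycle-neighbour p of w cannot reach u avoiding w: if u ≠ w, then p and the last
    -- vertex t of the route, both neighbours of w, would be linked, putting t on the cycle
    cycle-beyond-route : ∀ {p} → Adj G w p → OnCycle p C → ¬ WalkIn (_≢ w) p u
    cycle-beyond-route {p} wp p-on W with route
    ... | inj₁ u≡w = last-in W u≡w
    ... | inj₂ (t , t-off , tw , W′) = t-off (proj₂ (edge-on-cycle C (EdgesAt.edge-q
            (closes-cycle wp (adj-sym tw) (on≢off p-on t-off)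
              (W ++ʷ weaken (λ (off , _) → ≢-sym (on≢off w-on off)) W′)))))

    module At (q : Fin n) (reach? : ∀ a k → Dec (WalkIn (λ i → i ≢ v × i ≢ w) a k)) where
      open Construction G v w q public
      open Components reach? public

      -- a neighbour a ≠ u of v reaches no neighbour of w, since otherwise a and u are linked
      far-from-w : ∀ {a k} → Adj G v a → a ≢ u → Reach a k → ¬ Adj G w k
      far-from-w va a≢u r wk = lonely-v va vu (≢-sym a≢u)
        (towards-u (extend (weaken proj₁ r) (adj-sym wk) w≢v))

      pendant : ∀ {a} → Adj G v a → a ≢ u → Pendant v a
      pendant {a} va a≢u = record
        { special = inj₁ refl ; inner = neighbour-≢ va , a≢w ; edge = va
        ; positive = sign-positive {v} {a} (inj₁ (≢-sym w≢v)) ; only = only }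
        where
          a≢w : a ≢ w
          a≢w refl = lonely-v va vu (≢-sym a≢u) (towards-u (halt w≢v))
          only : ∀ {s k} → Special s → Adj G s k → Reach a k → s ≡ v × k ≡ a
          only (inj₁ refl) vk r with _ ≟ a
          ... | yes k≡a = refl , k≡a
          ... | no k≢a  = ⊥-elim (lonely-v va vk k≢a (weaken proj₁ r))
          only (inj₂ refl) wk r = ⊥-elim (far-from-w va a≢u r wk)

    module Balancing (p q : Fin n) (wp : Adj G w p) (wq : Adj G w q) (p≢q : p ≢ q)
                     (around : WalkIn (λ i → OnCycle i C × i ≢ w) p q)
                     (reach? : ∀ a k → Dec (WalkIn (λ i → i ≢ v × i ≢ w) a k)) where
      open At q reach? public

      edges : EdgesAt w p q
      edges = closes-cycle wp wq p≢q (weaken proj₂ around)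

      on-cycle-inner : ∀ {i} → OnCycle i C × i ≢ w → Inner i
      on-cycle-inner (on , i≢w) = on≢off on v-off , i≢w

      -- the component of p contains no neighbour of v: those other than u would be linked
      -- to u, and u is excluded by cycle-beyond-route
      avoids-v-neighbours : ∀ {k} → Adj G v k → ¬ Reach p k
      avoids-v-neighbours {k} vk r with k ≟ u
      ... | no k≢u   = lonely-v vk vu (≢-sym k≢u)
                         (towards-u (extend (reverse (weaken proj₁ r)) (adj-sym wp) w≢v))
      ... | yes refl = cycle-beyond-route wp (proj₁ (first-in around)) (weaken proj₂ r)

      balanced-p : Balanced p
      balanced-p = record
        { inner = on-cycle-inner (first-in around) ; edge-p = wp ; edge-q = wq ; p≢q = p≢q
        ; linked = weaken on-cycle-inner around ; only = only }
        where
          only : ∀ {s k} → Special s → Adj G s k → Reach p k → s ≡ w × (k ≡ p ⊎ k ≡ q)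
          only (inj₁ refl) vk r = ⊥-elim (avoids-v-neighbours vk r)
          only (inj₂ refl) wk r with _ ≟ p
          ... | yes k≡p = refl , inj₁ k≡p
          ... | no k≢p  = refl , EdgesAt.no-other edges _
                                   (EdgesAt.edge-q (closes-cycle wp wk (≢-sym k≢p) (weaken proj₂ r)))

    -- two neighbours a, b ≠ u of v give a pendant pair, far from the balanced component
    off-cycle : ⊥
    off-cycle with pick-two (without u (neighbours v (subst (3 ≤_) (≡-sym deg≡3) ≤-refl)))
                 | detour C w-on
    ... | a , b , (va , a≢u) , (vb , b≢u) , a≢b | p , q , wp , wq , p≢q , around =
      ¬¬-decide _ λ reach? → let open Balancing p q wp wq p≢q around reach? in
        pendant-pair-and-balanced (pendant va a≢u) (pendant vb b≢u)
          (λ r → lonely-v vb va a≢b (weaken proj₁ r)) balanced-p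
          (λ r → far-from-w va a≢u r wp) (λ r → far-from-w vb b≢u r wp)
          (H A A∈𝒮)

corollary2p9 : (ℝ : RealField) (n : ℕ) (G : Graph n) (U : Unicyclic G) →
               ((∃ λ v → 4 ≤ degree G v) ⊎
                (∃ λ v → degree G v ≡ 3 × ¬ OnCycle v (proj₁ (proj₂ U)))) →
               ¬ InGSSP ℝ G
corollary2p9 ℝ n G (connected , C , only-cycle) (inj₁ (v , deg≥4)) H =
  Cases.HighDegree.high-degree ℝ G C only-cycle v deg≥4 H
corollary2p9 ℝ n G (connected , C , only-cycle) (inj₂ (v , deg≡3 , v-off)) H =
  Cases.OffCycle.off-cycle ℝ G C only-cycle v v-off deg≡3 connected H
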